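{- Let $i\geqslant 2$ be a natural number, let $a_1,\dots,a_i$ and $b_0,\dots,b_{i-1}$ be nonnegative real numbers, and set $a_0=b_i:=0$. Then $$\sum_{j=0}^{i-1} b_j a_{j+1}\geqslant \min\{(b_j+a_j)(b_{j+1}+a_{j+1}) : 0\leqslant j\leqslant i-1\}.$$ -}

module Defs where

open import Level using (Level; _⊔_)
open import Data.Nat using (ℕ)
open import Data.Fin using (Fin; zero; suc)
open import Data.Product using (_×_)
open import Relation.Nullary using (¬_)
open import Algebra.Bundles using (CommutativeRing)
open import Relation.Binary.Structures using (IsTotalOrder)

-- We state the
-- (first-order, polynomial) inequality over an arbitrary totally ordered
-- integral domain; ℝ is an instance, and conversely every such ring embeds
-- order-preservingly into a real closed field, so the statement over all
-- such rings is equivalent to the statement over ℝ.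
record OrderedDomain (c ℓ₁ ℓ₂ : Level) : Set (Level.suc (c ⊔ ℓ₁ ⊔ ℓ₂)) where
  field
    commutativeRing : CommutativeRing c ℓ₁
  open CommutativeRing commutativeRing public
  infix 4 _≤_ _<_
  field
    _≤_          : Carrier → Carrier → Set ℓ₂
    isTotalOrder : IsTotalOrder _≈_ _≤_
  _<_ : Carrier → Carrier → Set (ℓ₁ ⊔ ℓ₂)
  x < y = (x ≤ y) × (¬ (x ≈ y))
  field
    +-mono-≤      : ∀ {x y} z → x ≤ y → x + z ≤ y + z
    *-nonneg      : ∀ {x y} → 0# ≤ x → 0# ≤ y → 0# ≤ x * y
    *-pos         : ∀ {x y} → 0# < x → 0# < y → 0# < x * y

module _ {c ℓ₁ ℓ₂} (R : OrderedDomain c ℓ₁ ℓ₂) where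
  open OrderedDomain R using (Carrier; 0#; _+_)

  sumFin : (n : ℕ) → (Fin n → Carrier) → Carrier
  sumFin ℕ.zero    f = 0#
  sumFin (ℕ.suc n) f = f zero + sumFin n (λ k → f (suc k))

  -- Given a : Fin i → Carrier with (a k) standing for a_{k+1},
  -- aExt gives the sequence a_0, …, a_i with a_0 = 0.
  aExt : ∀ {i} → (Fin i → Carrier) → Fin (ℕ.suc i) → Carrier
  aExt a zero    = 0#
  aExt a (suc k) = a k

  -- Given b : Fin i → Carrier with (b k) standing for b_k,
  -- bExt gives the sequence b_0, …, b_i with b_i = 0.
  bExt : ∀ {i} → (Fin i → Carrier) → Fin (ℕ.suc i) → Carrier
  bExt {ℕ.zero}  b zero    = 0#
  bExt {ℕ.suc i} b zero    = b zero
  bExt {ℕ.suc i} b (suc k) = bExt (λ m → b (suc m)) k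

{-# OPTIONS --safe #-}
-- Write c_j = b_j + a_j, so the products in the minimum are c_j c_{j+1}.  If b_0 ≤ a_2 then
-- c_0 c_1 = b_0 b_1 + b_0 a_1 ≤ b_1 a_2 + b_0 a_1 is already bounded by the sum.  Otherwise
-- a_2 ≤ b_0, and we delete b_0 and a_1 and replace b_1 by c_1: the new data are again
-- nonnegative, their products c_j c_{j+1} are the old ones with j ≥ 1, and their sum changes
-- by a_1 (a_2 − b_0) ≤ 0.  Induction on i finishes the proof; for i = 1 both sides are b_0 a_1.
module Submission where

open import Defs
open import Data.Nat using (ℕ) renaming (_≤_ to _≤ℕ_)
open import Data.Fin using (Fin; zero; suc; inject₁)
open import Data.Product using (∃; _,_)
open import Data.Sum using (inj₁; inj₂)
open import Data.Maybe using (nothing)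
open import Data.Vec.Functional using (_∷_; tail)
open import Relation.Binary.Bundles using (Poset)
open import Relation.Binary.Structures using (IsTotalOrder)
open import Tactic.RingSolver.Core.AlmostCommutativeRing using (fromCommutativeRing)
import Tactic.RingSolver.NonReflective as RingSolver
import Relation.Binary.Reasoning.PartialOrder as PosetReasoning
import Algebra.Properties.Group as GroupProperties

module _ {c ℓ₁ ℓ₂} (R : OrderedDomain c ℓ₁ ℓ₂) where
  open OrderedDomain R hiding (zero)
  open IsTotalOrder isTotalOrder using (total) renaming (reflexive to ≤-reflexive)
  -- Without a zero test the solver cannot cancel terms such as x * y − x * y.
  open RingSolver (fromCommutativeRing commutativeRing (λ _ → nothing))
    using (solve; _⊜_; _⊕_; _⊗_)
  open GroupProperties +-group using (//-rightDividesˡ)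

  poset : Poset c ℓ₁ ℓ₂
  poset = record { isPartialOrder = IsTotalOrder.isPartialOrder isTotalOrder }

  open PosetReasoning poset

  +-monoʳ-≤ : ∀ x {y z} → y ≤ z → x + y ≤ x + z
  +-monoʳ-≤ x {y} {z} y≤z = begin
    x + y ≈⟨ +-comm x y ⟩
    y + x ≤⟨ +-mono-≤ x y≤z ⟩
    z + x ≈⟨ +-comm z x ⟩
    x + z ∎

  x≤x+y : ∀ x {y} → 0# ≤ y → x ≤ x + y
  x≤x+y x {y} 0≤y = begin
    x      ≈⟨ +-identityʳ x ⟨
    x + 0# ≤⟨ +-monoʳ-≤ x 0≤y ⟩
    x + y  ∎

  +-nonneg : ∀ {x y} → 0# ≤ x → 0# ≤ y → 0# ≤ x + y
  +-nonneg {x} {y} 0≤x 0≤y = begin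
    0#     ≤⟨ 0≤x ⟩
    x      ≤⟨ x≤x+y x 0≤y ⟩
    x + y  ∎

  *-monoˡ-≤-nonNeg : ∀ {x y z} → 0# ≤ x → y ≤ z → x * y ≤ x * z
  *-monoˡ-≤-nonNeg {x} {y} {z} 0≤x y≤z = begin
    x * y                ≈⟨ +-identityˡ (x * y) ⟨
    0# + x * y           ≤⟨ +-mono-≤ (x * y) (*-nonneg 0≤x 0≤z-y) ⟩
    x * (z - y) + x * y  ≈⟨ distribˡ x (z - y) y ⟨
    x * (z - y + y)      ≈⟨ *-congˡ (//-rightDividesˡ y z) ⟩
    x * z                ∎
    where
    0≤z-y : 0# ≤ z - y
    0≤z-y = begin
      0#     ≈⟨ -‿inverseʳ y ⟨
      y - y  ≤⟨ +-mono-≤ (- y) y≤z ⟩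
      z - y  ∎

  sumFin-nonneg : ∀ n (f : Fin n → Carrier) → (∀ k → 0# ≤ f k) → 0# ≤ sumFin R n f
  sumFin-nonneg ℕ.zero    f 0≤f = ≤-reflexive refl
  sumFin-nonneg (ℕ.suc n) f 0≤f = +-nonneg (0≤f zero) (sumFin-nonneg n (tail f) (λ k → 0≤f (suc k)))

  adjacentProduct : ∀ {n} (a b : Fin n → Carrier) → Fin n → Carrier
  adjacentProduct a b j =
    (bExt R b (inject₁ j) + aExt R a (inject₁ j)) * (bExt R b (suc j) + aExt R a (suc j))

  crossSum : ∀ {n} (a b : Fin n → Carrier) → Carrier
  crossSum {n} a b = sumFin R n (λ k → b k * a k)

  crossSum-nonneg : ∀ {n} (a b : Fin n → Carrier) → (∀ k → 0# ≤ a k) → (∀ k → 0# ≤ b k) →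
                    0# ≤ crossSum a b
  crossSum-nonneg {n} a b 0≤a 0≤b = sumFin-nonneg n _ (λ k → *-nonneg (0≤b k) (0≤a k))

  adjacentProduct≈crossSum : (a b : Fin 1 → Carrier) → adjacentProduct a b zero ≈ crossSum a b
  adjacentProduct≈crossSum a b = begin-equality
    (b zero + 0#) * (0# + a zero)  ≈⟨ *-cong (+-identityʳ (b zero)) (+-identityˡ (a zero)) ⟩
    b zero * a zero                ≈⟨ +-identityʳ (b zero * a zero) ⟨
    b zero * a zero + 0#           ∎

  -- With paper indices (a k = a_{k+1}, b k = b_k): b_0 and a_1 are deleted and b_1 becomes
  -- b_1 + a_1; the corresponding new a is tail a.
  mergeB : ∀ {m} (a b : Fin (ℕ.suc (ℕ.suc m)) → Carrier) → Fin (ℕ.suc m) → Carrier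
  mergeB a b = (b (suc zero) + a zero) ∷ tail (tail b)

  mergeB-nonneg : ∀ {m} (a b : Fin (ℕ.suc (ℕ.suc m)) → Carrier) →
                  (∀ k → 0# ≤ a k) → (∀ k → 0# ≤ b k) → ∀ k → 0# ≤ mergeB a b k
  mergeB-nonneg a b 0≤a 0≤b zero    = +-nonneg (0≤b (suc zero)) (0≤a zero)
  mergeB-nonneg a b 0≤a 0≤b (suc k) = 0≤b (suc (suc k))

  adjacentProduct-mergeB : ∀ {m} (a b : Fin (ℕ.suc (ℕ.suc m)) → Carrier) j →
                           adjacentProduct (tail a) (mergeB a b) j ≈ adjacentProduct a b (suc j)
  adjacentProduct-mergeB a b zero    = *-congʳ (+-identityʳ (b (suc zero) + a zero))
  adjacentProduct-mergeB a b (suc j) = refl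

  module _ {m} (a b : Fin (ℕ.suc (ℕ.suc m)) → Carrier) where
    private
      b₀ b₁ a₁ a₂ rest : Carrier
      b₀   = b zero
      b₁   = b (suc zero)
      a₁   = a zero
      a₂   = a (suc zero)
      rest = crossSum (tail (tail a)) (tail (tail b))

    crossSum-mergeB-≤ : 0# ≤ a₁ → a₂ ≤ b₀ → crossSum (tail a) (mergeB a b) ≤ crossSum a b
    crossSum-mergeB-≤ 0≤a₁ a₂≤b₀ = begin
      (b₁ + a₁) * a₂ + rest       ≈⟨ solve 4 (λ b₁ a₁ a₂ r → (b₁ ⊕ a₁) ⊗ a₂ ⊕ r ⊜ (a₁ ⊗ a₂ ⊕ (b₁ ⊗ a₂ ⊕ r)))
                                             refl b₁ a₁ a₂ rest ⟩
      a₁ * a₂ + (b₁ * a₂ + rest)  ≤⟨ +-mono-≤ (b₁ * a₂ + rest) (*-monoˡ-≤-nonNeg 0≤a₁ a₂≤b₀) ⟩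
      a₁ * b₀ + (b₁ * a₂ + rest)  ≈⟨ +-congʳ (*-comm a₁ b₀) ⟩
      b₀ * a₁ + (b₁ * a₂ + rest)  ∎

    adjacentProduct-zero-≤ : (∀ k → 0# ≤ a k) → (∀ k → 0# ≤ b k) → b₀ ≤ a₂ →
                             adjacentProduct a b zero ≤ crossSum a b
    adjacentProduct-zero-≤ 0≤a 0≤b b₀≤a₂ = begin
      (b₀ + 0#) * (b₁ + a₁)       ≈⟨ *-congʳ (+-identityʳ b₀) ⟩
      b₀ * (b₁ + a₁)              ≈⟨ solve 3 (λ b₀ b₁ a₁ → b₀ ⊗ (b₁ ⊕ a₁) ⊜ (b₀ ⊗ a₁ ⊕ b₁ ⊗ b₀))
                                             refl b₀ b₁ a₁ ⟩
      b₀ * a₁ + b₁ * b₀           ≤⟨ +-monoʳ-≤ (b₀ * a₁) (*-monoˡ-≤-nonNeg (0≤b (suc zero)) b₀≤a₂) ⟩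
      b₀ * a₁ + b₁ * a₂           ≤⟨ +-monoʳ-≤ (b₀ * a₁) (x≤x+y (b₁ * a₂) 0≤rest) ⟩
      b₀ * a₁ + (b₁ * a₂ + rest)  ∎
      where
      0≤rest : 0# ≤ rest
      0≤rest = crossSum-nonneg (tail (tail a)) (tail (tail b))
                 (λ k → 0≤a (suc (suc k))) (λ k → 0≤b (suc (suc k)))

  ∃-adjacentProduct≤crossSum : ∀ n (a b : Fin (ℕ.suc n) → Carrier) →
                               (∀ k → 0# ≤ a k) → (∀ k → 0# ≤ b k) →
                               ∃ λ j → adjacentProduct a b j ≤ crossSum a b
  ∃-adjacentProduct≤crossSum ℕ.zero a b _ _ = zero , ≤-reflexive (adjacentProduct≈crossSum a b)
  ∃-adjacentProduct≤crossSum (ℕ.suc m) a b 0≤a 0≤b with total (b zero) (a (suc zero))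
  ... | inj₁ b₀≤a₂ = zero , adjacentProduct-zero-≤ a b 0≤a 0≤b b₀≤a₂
  ... | inj₂ a₂≤b₀
    with ∃-adjacentProduct≤crossSum m (tail a) (mergeB a b) (λ k → 0≤a (suc k)) (mergeB-nonneg a b 0≤a 0≤b)
  ... | j , P≤S = suc j , (begin
    adjacentProduct a b (suc j)              ≈⟨ adjacentProduct-mergeB a b j ⟨
    adjacentProduct (tail a) (mergeB a b) j  ≤⟨ P≤S ⟩
    crossSum (tail a) (mergeB a b)           ≤⟨ crossSum-mergeB-≤ a b (0≤a zero) a₂≤b₀ ⟩
    crossSum a b                             ∎)

lemma4 : ∀ {c ℓ₁ ℓ₂} (R : OrderedDomain c ℓ₁ ℓ₂) → let open OrderedDomain R in
    (i : ℕ) → 2 ≤ℕ i → (a b : Fin i → Carrier) →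
    (∀ k → 0# ≤ a k) → (∀ k → 0# ≤ b k) →
    ∃ λ (j : Fin i) →
      ((bExt R b (inject₁ j) + aExt R a (inject₁ j)) * (bExt R b (suc j) + aExt R a (suc j)))
        ≤ sumFin R i (λ k → b k * a k)
lemma4 R ℕ.zero ()
lemma4 R (ℕ.suc n) _ = ∃-adjacentProduct≤crossSum R n
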